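{- Let $G$ be a finite bipartite graph with at least one edge and with bipartition classes $X$ and $Y$. Suppose there exists a graph automorphism $f$ of $G$ (a bijection $f\colon V(G)\to V(G)$ such that $\{v_1,v_2\}\in E(G)$ if and only if $\{f(v_1),f(v_2)\}\in E(G)$) with $f(X)=Y$ and $f(Y)=X$. Then $G$ satisfies the Union Closed Conjecture, i.e. $X$ contains a rare vertex and $Y$ contains a rare vertex.
   Context: A stable set of a graph is a set of pairwise non-adjacent vertices; a maximal stable set is a stable set to which no further vertex can be added while remaining stable. A vertex $v$ of a graph is called rare if $v$ lies in at most half of the maximal stable sets of the graph. A bipartite graph with bipartition classes $X,Y$ is said to satisfy the Union Closed Conjecture (graph formulation) if each of $X$ and $Y$ contains a rare vertex. -}

module Defs where

open import Data.Nat using (ℕ; zero; suc; _*_; _≤_)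
open import Data.Bool using (Bool; true; false; not; _∧_; _∨_; if_then_else_)
open import Data.Fin using (Fin)
open import Data.Vec using (Vec; []; _∷_; lookup)
open import Data.List using (List; []; _∷_; map; _++_; length; filterᵇ; allFin)
open import Data.Bool.ListAction using (all; any)
open import Data.Product using (Σ; _×_; ∃₂)
open import Relation.Binary.PropositionalEquality using (_≡_)
open import Function.Definitions using (Bijective)

record Graph (n : ℕ) : Set where
  field
    adj   : Fin n → Fin n → Bool
    sym   : ∀ u v → adj u v ≡ adj v u
    irrefl : ∀ v → adj v v ≡ false
open Graph public

VSet : ℕ → Set
VSet n = Vec Bool n

_∈ᵇ_ : ∀ {n} → Fin n → VSet n → Bool
v ∈ᵇ S = lookup S v

allSets : (n : ℕ) → List (VSet n)
allSets zero = [] ∷ []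
allSets (suc n) = map (false ∷_) (allSets n) ++ map (true ∷_) (allSets n)

module _ {n : ℕ} (G : Graph n) where
  isStable : VSet n → Bool
  isStable S = all (λ u → all (λ v → not ((u ∈ᵇ S) ∧ (v ∈ᵇ S) ∧ adj G u v)) (allFin n)) (allFin n)

  -- S is maximal stable: stable, and no vertex outside S can be added.
  -- (A vertex v ∉ S can be added iff it has no neighbour in S.)
  isMaximalStable : VSet n → Bool
  isMaximalStable S =
    isStable S ∧
    all (λ v → (v ∈ᵇ S) ∨ any (λ u → (u ∈ᵇ S) ∧ adj G u v) (allFin n)) (allFin n)

  maximalStableSets : List (VSet n)
  maximalStableSets = filterᵇ isMaximalStable (allSets n)

  Rare : Fin n → Set
  Rare v = 2 * length (filterᵇ (v ∈ᵇ_) maximalStableSets) ≤ length maximalStableSets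

  -- Bipartite with bipartition classes X = {v | side v ≡ true}, Y = {v | side v ≡ false}.
  IsBipartition : (Fin n → Bool) → Set
  IsBipartition side = ∀ u v → adj G u v ≡ true → side u ≡ not (side v)

  HasEdge : Set
  HasEdge = ∃₂ λ u v → adj G u v ≡ true

  IsAutomorphism : (Fin n → Fin n) → Set
  IsAutomorphism f = Bijective _≡_ _≡_ f × (∀ u v → adj G u v ≡ adj G (f u) (f v))

  SatisfiesUCC : (Fin n → Bool) → Set
  SatisfiesUCC side =
    (Σ (Fin n) λ x → side x ≡ true × Rare x) ×
    (Σ (Fin n) λ y → side y ≡ false × Rare y)

{-# OPTIONS --safe #-}
-- Two adjacent vertices never lie in a common maximal stable set, so some endpoint of an
-- edge is rare. For an automorphism f, S ↦ S ∘ f maps the maximal stable sets containing f w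
-- injectively to those containing w, so f w is rare whenever w is. As f swaps the classes,
-- w and f w are rare vertices on opposite sides.
module Submission where

open import Defs
open import Data.Nat using (ℕ; zero; suc; _+_; _*_; _≤_; z≤n; s≤s)
open import Data.Nat.Properties
  using (≤-total; ≤-trans; ≤-reflexive; m≤n⇒m≤1+n; +-suc; +-comm; +-identityʳ; +-monoʳ-≤; *-monoʳ-≤; module ≤-Reasoning)
open import Data.Bool using (Bool; true; false; not; _∧_; _∨_; T)
open import Data.Bool.Properties using (T-∧)
open import Data.Bool.ListAction using (all; any)
open import Data.Fin using (Fin)
open import Data.Vec using ([]; _∷_; lookup; tabulate)
open import Data.Vec.Properties using (∷-injectiveʳ; lookup∘tabulate; tabulate∘lookup; tabulate-cong)
open import Data.List using (List; []; _∷_; map; length; filterᵇ; allFin)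
open import Data.List.Properties using (length-map; length-removeAt′)
open import Data.List.Membership.Propositional using (_∈_; lose)
open import Data.List.Membership.Propositional.Properties
  using (∈-++⁺ˡ; ∈-++⁺ʳ; ∈-map⁺; ∈-map⁻; ∈-filter⁺; ∈-filter⁻; ∈-allFin)
open import Data.List.Relation.Binary.Subset.Propositional using (_⊆_)
open import Data.List.Relation.Unary.All using (All; []; _∷_)
import Data.List.Relation.Unary.All as All
open import Data.List.Relation.Unary.All.Properties using (all⁺; all⁻)
open import Data.List.Relation.Unary.Any using (here; there; index; satisfied; _─_)
open import Data.List.Relation.Unary.Any.Properties using (any⁺; any⁻)
open import Data.List.Relation.Unary.AllPairs using ([]; _∷_)
open import Data.List.Relation.Unary.Unique.Propositional using (Unique)
import Data.List.Relation.Unary.Unique.Propositional.Properties as Unique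
open import Data.Product using (∃; _×_; _,_; proj₁; proj₂)
open import Data.Sum using (_⊎_; inj₁; inj₂; [_,_]′)
open import Data.Unit using (tt)
open import Function using (_∘_; id; const)
open import Function.Bundles using (_⇔_; mk⇔; Equivalence)
open import Function.Consequences.Propositional using (surjective⇒strictlySurjective)
open import Relation.Nullary using (¬_; contradiction)
open import Relation.Nullary.Decidable using (T?)
open import Relation.Binary.PropositionalEquality
  using (_≡_; _≢_; refl; cong; subst; module ≡-Reasoning)
import Relation.Binary.PropositionalEquality as ≡

open Equivalence using (to; from)

module _ {A : Set} where

  ∈-─ : ∀ {x z : A} {ys} (x∈ys : x ∈ ys) → z ∈ ys → x ≢ z → z ∈ (ys ─ x∈ys)
  ∈-─ (here refl) (here refl)  x≢z = contradiction refl x≢z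
  ∈-─ (here refl) (there z∈ys) _   = z∈ys
  ∈-─ (there _)   (here refl)  _   = here refl
  ∈-─ (there x∈ys) (there z∈ys) x≢z = there (∈-─ x∈ys z∈ys x≢z)

  unique∧⊆⇒length≤ : ∀ {xs ys : List A} → Unique xs → xs ⊆ ys → length xs ≤ length ys
  unique∧⊆⇒length≤ {[]}     _                 _     = z≤n
  unique∧⊆⇒length≤ {x ∷ xs} {ys} (x∉xs ∷ xs!) xs⊆ys = begin
    suc (length xs)          ≤⟨ s≤s (unique∧⊆⇒length≤ xs! xs⊆ys─x) ⟩
    suc (length (ys ─ x∈ys)) ≡⟨ length-removeAt′ ys (index x∈ys) ⟨
    length ys                ∎
    where
    open ≤-Reasoning
    x∈ys : x ∈ ys
    x∈ys = xs⊆ys (here refl)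
    xs⊆ys─x : xs ⊆ (ys ─ x∈ys)
    xs⊆ys─x z∈xs = ∈-─ x∈ys (xs⊆ys (there z∈xs)) (All.lookup x∉xs z∈xs)

  length-filterᵇ-disjoint : ∀ (p q : A → Bool) xs → All (λ x → T (p x) → ¬ T (q x)) xs →
    length (filterᵇ p xs) + length (filterᵇ q xs) ≤ length xs
  length-filterᵇ-disjoint p q []       []                 = z≤n
  length-filterᵇ-disjoint p q (x ∷ xs) (px⇒¬qx ∷ disjoint)
    with p x | q x | length-filterᵇ-disjoint p q xs disjoint
  ... | true  | true  | _  = contradiction tt (px⇒¬qx tt)
  ... | true  | false | ih = s≤s ih
  ... | false | true  | ih = subst (_≤ suc (length xs)) (≡.sym (+-suc _ _)) (s≤s ih)
  ... | false | false | ih = m≤n⇒m≤1+n ih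

m+n≤o⇒2m≤o⊎2n≤o : ∀ m n {o} → m + n ≤ o → 2 * m ≤ o ⊎ 2 * n ≤ o
m+n≤o⇒2m≤o⊎2n≤o m n m+n≤o with ≤-total m n
... | inj₁ m≤n = inj₁ (≤-trans (+-monoʳ-≤ m (≤-trans (≤-reflexive (+-identityʳ m)) m≤n)) m+n≤o)
... | inj₂ n≤m = inj₂ (≤-trans (+-monoʳ-≤ n (≤-trans (≤-reflexive (+-identityʳ n)) n≤m))
                               (≤-trans (≤-reflexive (+-comm n m)) m+n≤o))

T-all-allFin : ∀ {n} {p : Fin n → Bool} → T (all p (allFin n)) ⇔ (∀ i → T (p i))
T-all-allFin {n} {p} = mk⇔
  (λ h i → All.lookup (all⁺ p (allFin n) h) (∈-allFin i))
  (λ h → all⁻ p {allFin n} (All.tabulate (λ {i} _ → h i)))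

T-any-allFin : ∀ {n} {p : Fin n → Bool} → T (any p (allFin n)) ⇔ ∃ (T ∘ p)
T-any-allFin {n} {p} = mk⇔
  (λ h → satisfied (any⁻ p (allFin n) h))
  (λ (i , pi) → any⁺ p (lose (∈-allFin i) pi))

T-nand³ : ∀ {a b c} → T (not (a ∧ b ∧ c)) ⇔ (T a → T b → ¬ T c)
T-nand³ {true}  {true}  {true}  = mk⇔ (λ ()) (λ h → h tt tt tt)
T-nand³ {true}  {true}  {false} = mk⇔ (λ _ _ _ ()) (const tt)
T-nand³ {true}  {false}         = mk⇔ (λ _ _ ()) (const tt)
T-nand³ {false}                 = mk⇔ (λ _ ()) (const tt)

T-∨-¬ˡ : ∀ {a b} → T (a ∨ b) ⇔ (¬ T a → T b)
T-∨-¬ˡ {true}  = mk⇔ (λ _ ¬a → contradiction tt ¬a) (const tt)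
T-∨-¬ˡ {false} = mk⇔ (λ b _ → b) (λ h → h id)

∈-allSets : ∀ {n} (S : VSet n) → S ∈ allSets n
∈-allSets []          = here refl
∈-allSets (false ∷ S) = ∈-++⁺ˡ (∈-map⁺ (false ∷_) (∈-allSets S))
∈-allSets (true ∷ S)  = ∈-++⁺ʳ _ (∈-map⁺ (true ∷_) (∈-allSets S))

unique-allSets : ∀ n → Unique (allSets n)
unique-allSets zero    = [] ∷ []
unique-allSets (suc n) =
  Unique.++⁺ (Unique.map⁺ ∷-injectiveʳ (unique-allSets n)) (Unique.map⁺ ∷-injectiveʳ (unique-allSets n))
             heads-differ
  where
  heads-differ : ∀ {S} → ¬ (S ∈ map (false ∷_) (allSets n) × S ∈ map (true ∷_) (allSets n))
  heads-differ (S∈ , S∈′) with ∈-map⁻ (false ∷_) S∈ | ∈-map⁻ (true ∷_) S∈′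
  ... | _ , _ , refl | _ , _ , ()

module _ {n : ℕ} (G : Graph n) where

  record IsMaximalStable (S : VSet n) : Set where
    field
      stable     : ∀ {u v} → T (u ∈ᵇ S) → T (v ∈ᵇ S) → ¬ T (adj G u v)
      dominating : ∀ {v} → ¬ T (v ∈ᵇ S) → ∃ λ u → T (u ∈ᵇ S) × T (adj G u v)
  open IsMaximalStable

  T-isMaximalStable : ∀ {S} → T (isMaximalStable G S) ⇔ IsMaximalStable S
  T-isMaximalStable {S} = mk⇔ sound complete
    where
    nonadjacent : Fin n → Fin n → Bool
    nonadjacent u v = not ((u ∈ᵇ S) ∧ (v ∈ᵇ S) ∧ adj G u v)

    neighbourIn : Fin n → Fin n → Bool
    neighbourIn v u = (u ∈ᵇ S) ∧ adj G u v

    dominated : Fin n → Bool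
    dominated v = (v ∈ᵇ S) ∨ any (neighbourIn v) (allFin n)

    T-isStable : T (isStable G S) ⇔ (∀ u v → T (nonadjacent u v))
    T-isStable = mk⇔
      (λ h u → to T-all-allFin (to (T-all-allFin {p = λ u → all (nonadjacent u) (allFin n)}) h u))
      (λ h → from (T-all-allFin {p = λ u → all (nonadjacent u) (allFin n)}) (λ u → from T-all-allFin (h u)))

    T-dominated : ∀ v → T (dominated v) ⇔ (¬ T (v ∈ᵇ S) → ∃ λ u → T (u ∈ᵇ S) × T (adj G u v))
    T-dominated v = mk⇔
      (λ h ¬v∈S → let u , u~v = to (T-any-allFin {p = neighbourIn v}) (to T-∨-¬ˡ h ¬v∈S) in u , to T-∧ u~v)
      (λ h → from T-∨-¬ˡ (λ ¬v∈S → let u , u∈S , u~v = h ¬v∈S in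
                                     from (T-any-allFin {p = neighbourIn v}) (u , from T-∧ (u∈S , u~v))))

    sound : T (isMaximalStable G S) → IsMaximalStable S
    sound h = record
      { stable     = λ {u} {v} → to T-nand³ (to T-isStable (proj₁ (to T-∧ h)) u v)
      ; dominating = λ {v} → to (T-dominated v) (to (T-all-allFin {p = dominated}) (proj₂ (to T-∧ h)) v)
      }

    complete : IsMaximalStable S → T (isMaximalStable G S)
    complete m = from T-∧
      ( from T-isStable (λ u v → from T-nand³ (stable m))
      , from (T-all-allFin {p = dominated}) (λ v → from (T-dominated v) (dominating m)))

  ∈-maximalStableSets : ∀ {S} → S ∈ maximalStableSets G ⇔ IsMaximalStable S
  ∈-maximalStableSets {S} = mk⇔
    (λ S∈ → to T-isMaximalStable (proj₂ (∈-filter⁻ (T? ∘ isMaximalStable G) {xs = allSets n} S∈)))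
    (λ m → ∈-filter⁺ (T? ∘ isMaximalStable G) (∈-allSets S) (from T-isMaximalStable m))

  unique-maximalStableSets : Unique (maximalStableSets G)
  unique-maximalStableSets = Unique.filter⁺ (T? ∘ isMaximalStable G) (unique-allSets n)

  adjacent⇒Rare⊎Rare : ∀ {u v} → adj G u v ≡ true → Rare G u ⊎ Rare G v
  adjacent⇒Rare⊎Rare {u} {v} u~v = m+n≤o⇒2m≤o⊎2n≤o (occurrences u) (occurrences v)
    (length-filterᵇ-disjoint (u ∈ᵇ_) (v ∈ᵇ_) (maximalStableSets G)
      (All.tabulate (λ S∈ u∈S v∈S → stable (to ∈-maximalStableSets S∈) u∈S v∈S (subst T (≡.sym u~v) tt))))
    where
    occurrences : Fin n → ℕ
    occurrences w = length (filterᵇ (w ∈ᵇ_) (maximalStableSets G))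

  HasEdge⇒∃Rare : HasEdge G → ∃ (Rare G)
  HasEdge⇒∃Rare (u , v , u~v) = [ (u ,_) , (v ,_) ]′ (adjacent⇒Rare⊎Rare u~v)

  opposite-Rare⇒SatisfiesUCC : ∀ {side : Fin n → Bool} {x y} → side x ≡ not (side y) →
    Rare G x → Rare G y → SatisfiesUCC G side
  opposite-Rare⇒SatisfiesUCC {side} {x} {y} x-side x-rare y-rare with side y in y-side
  ... | true  = (y , y-side , y-rare) , (x , x-side , x-rare)
  ... | false = (x , x-side , x-rare) , (y , y-side , y-rare)

  module _ {f : Fin n → Fin n} (f-aut : IsAutomorphism G f) where

    private
      f-onto : ∀ v → ∃ λ u → f u ≡ v
      f-onto = surjective⇒strictlySurjective (proj₂ (proj₁ f-aut))

      f-adj : ∀ u v → adj G u v ≡ adj G (f u) (f v)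
      f-adj = proj₂ f-aut

    pullback : VSet n → VSet n
    pullback S = tabulate (λ v → f v ∈ᵇ S)

    ∈ᵇ-pullback : ∀ S v → v ∈ᵇ pullback S ≡ f v ∈ᵇ S
    ∈ᵇ-pullback S = lookup∘tabulate (λ v → f v ∈ᵇ S)

    pullback-injective : ∀ {S S′} → pullback S ≡ pullback S′ → S ≡ S′
    pullback-injective {S} {S′} eq = begin
      S                     ≡⟨ tabulate∘lookup S ⟨
      tabulate (lookup S)   ≡⟨ tabulate-cong agree ⟩
      tabulate (lookup S′)  ≡⟨ tabulate∘lookup S′ ⟩
      S′                    ∎
      where
      open ≡-Reasoning
      agree : ∀ v → v ∈ᵇ S ≡ v ∈ᵇ S′
      agree v with u , refl ← f-onto v = begin
        f u ∈ᵇ S          ≡⟨ ∈ᵇ-pullback S u ⟨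
        u ∈ᵇ pullback S   ≡⟨ cong (u ∈ᵇ_) eq ⟩
        u ∈ᵇ pullback S′  ≡⟨ ∈ᵇ-pullback S′ u ⟩
        f u ∈ᵇ S′         ∎

    pullback-IsMaximalStable : ∀ {S} → IsMaximalStable S → IsMaximalStable (pullback S)
    pullback-IsMaximalStable {S} m = record
      { stable     = λ {u} {v} u∈ v∈ → stable m (pulled u u∈) (pulled v v∈) ∘ subst T (f-adj u v)
      ; dominating = λ {v} ¬v∈ → neighbour (dominating m (¬v∈ ∘ pushed v))
      }
      where
      pulled : ∀ v → T (v ∈ᵇ pullback S) → T (f v ∈ᵇ S)
      pulled v = subst T (∈ᵇ-pullback S v)

      pushed : ∀ v → T (f v ∈ᵇ S) → T (v ∈ᵇ pullback S)
      pushed v = subst T (≡.sym (∈ᵇ-pullback S v))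

      neighbour : ∀ {v} → (∃ λ w → T (w ∈ᵇ S) × T (adj G w (f v))) →
                  ∃ λ u → T (u ∈ᵇ pullback S) × T (adj G u v)
      neighbour {v} (w , w∈S , w~fv) with u , refl ← f-onto w =
        u , pushed u w∈S , subst T (≡.sym (f-adj u v)) w~fv

    Rare-image : ∀ {w} → Rare G w → Rare G (f w)
    Rare-image {w} = ≤-trans (*-monoʳ-≤ 2 image-occurrences≤)
      where
      open ≤-Reasoning
      M : List (VSet n)
      M = maximalStableSets G

      pullback-⊆ : map pullback (filterᵇ (f w ∈ᵇ_) M) ⊆ filterᵇ (w ∈ᵇ_) M
      pullback-⊆ S′∈ with S , S∈ , refl ← ∈-map⁻ pullback S′∈ =
        let S∈M , fw∈S = ∈-filter⁻ (T? ∘ (f w ∈ᵇ_)) {xs = M} S∈ in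
        ∈-filter⁺ (T? ∘ (w ∈ᵇ_))
          (from ∈-maximalStableSets (pullback-IsMaximalStable (to ∈-maximalStableSets S∈M)))
          (subst T (≡.sym (∈ᵇ-pullback S w)) fw∈S)

      image-occurrences≤ : length (filterᵇ (f w ∈ᵇ_) M) ≤ length (filterᵇ (w ∈ᵇ_) M)
      image-occurrences≤ = begin
        length (filterᵇ (f w ∈ᵇ_) M)               ≡⟨ length-map pullback (filterᵇ (f w ∈ᵇ_) M) ⟨
        length (map pullback (filterᵇ (f w ∈ᵇ_) M)) ≤⟨ unique∧⊆⇒length≤ pullbacks-unique pullback-⊆ ⟩
        length (filterᵇ (w ∈ᵇ_) M)                 ∎
        where
        pullbacks-unique : Unique (map pullback (filterᵇ (f w ∈ᵇ_) M))
        pullbacks-unique =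
          Unique.map⁺ pullback-injective (Unique.filter⁺ (T? ∘ (f w ∈ᵇ_)) unique-maximalStableSets)

theorem1 : (n : ℕ) (G : Graph n) (side : Fin n → Bool) →
    IsBipartition G side → HasEdge G →
    (f : Fin n → Fin n) → IsAutomorphism G f →
    (∀ v → side (f v) ≡ not (side v)) →
    SatisfiesUCC G side
theorem1 n G side _ edge f f-aut f-swaps =
  let w , w-rare = HasEdge⇒∃Rare G edge in
  opposite-Rare⇒SatisfiesUCC G (f-swaps w) (Rare-image G f-aut w-rare) w-rare
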